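{- Let $k\ge1$, let $G=(V,E)$ be a graph, and let $c$ be a proper edge coloring of $G$ using at most $k$ colors (from $\{1,\dots,k\}$). Let $H$ be the graph consisting of $k$ disjoint copies of $G$. Then there exists an ordering of the edges of $H$ such that, when the edges of $H$ are given in this order to Next-Fit with $k$ colors, for each of the $k$ copies of $G$ in $H$ the coloring Next-Fit produces on that copy is equivalent to $c$.
   Context: Online dual edge coloring with $k$ colors $1,\dots,k$: edges arrive one by one and each is irrevocably either given a color distinct from the colors of all previously colored adjacent edges, or rejected. Next-Fit (NF) remembers the last used color $c_{\text{last}}$ and colors each arriving edge with the first available color (not used on an adjacent edge) in the order $c_{\text{last}}+1,\dots,k,1,\dots,c_{\text{last}}$, rejecting it if none is available; the very first edge gets color 1. Two colorings of a graph are equivalent if one can be obtained from the other by renaming the colors. -}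

module Defs where

open import Data.Nat using (ℕ; _*_)
open import Data.Fin using (Fin; _≟_; _<?_; _≤?_; combine; remQuot)
open import Data.List using (List; []; _∷_; _++_; filter; allFin)
open import Data.Bool.ListAction using (any)
open import Data.Bool using (Bool; true; false; _∧_; _∨_; not; if_then_else_)
open import Data.Maybe using (Maybe; just; nothing)
open import Data.Product using (_×_; _,_; proj₁; proj₂; ∃)
open import Data.Sum using (_⊎_)
open import Relation.Nullary using (¬_; does)
open import Relation.Binary.PropositionalEquality using (_≡_; _≢_)

record Graph : Set where
  constructor mkGraph
  field
    nV   : ℕ
    nE   : ℕ
    ends : Fin nE → Fin nV × Fin nV
open Graph public

IsSimple : Graph → Set
IsSimple G =
  (∀ e → proj₁ (ends G e) ≢ proj₂ (ends G e)) ×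
  (∀ e f → ((ends G e ≡ ends G f) ⊎ (ends G e ≡ (proj₂ (ends G f) , proj₁ (ends G f)))) → e ≡ f)

Incident : (G : Graph) → Fin (nV G) → Fin (nE G) → Set
Incident G v e = (v ≡ proj₁ (ends G e)) ⊎ (v ≡ proj₂ (ends G e))

Adjacent : (G : Graph) → Fin (nE G) → Fin (nE G) → Set
Adjacent G e f = (e ≢ f) × ∃ (λ v → Incident G v e × Incident G v f)

-- proper edge coloring with colors Fin k (colour i ↔ colour i+1 of the paper)
IsProperEdgeColoring : (G : Graph) (k : ℕ) → (Fin (nE G) → Fin k) → Set
IsProperEdgeColoring G k c = ∀ e f → Adjacent G e f → c e ≢ c f

copies : ℕ → Graph → Graph
copies k G = mkGraph (k * nV G) (k * nE G) ends′
  where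
  ends′ : Fin (k * nE G) → Fin (k * nV G) × Fin (k * nV G)
  ends′ f with remQuot {k} (nE G) f
  ... | i , e = combine {k} i (proj₁ (ends G e)) , combine {k} i (proj₂ (ends G e))

private
  eqB : ∀ {n} → Fin n → Fin n → Bool
  eqB a b = does (a ≟ b)

adjB : (G : Graph) → Fin (nE G) → Fin (nE G) → Bool
adjB G e f =
  not (eqB e f) ∧
  (eqB (proj₁ (ends G e)) (proj₁ (ends G f)) ∨ eqB (proj₁ (ends G e)) (proj₂ (ends G f)) ∨
   eqB (proj₂ (ends G e)) (proj₁ (ends G f)) ∨ eqB (proj₂ (ends G e)) (proj₂ (ends G f)))

availableB : (G : Graph) (k : ℕ) → List (Fin (nE G) × Fin k) → Fin (nE G) → Fin k → Bool
availableB G k assigned e c =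
  not (any (λ p → adjB G e (proj₁ p) ∧ eqB c (proj₂ p)) assigned)

-- order in which colours are tried: c_last+1, …, k, 1, …, c_last
-- (initially, with no last colour, 1, …, k, so the first edge gets colour 1)
candidates : (k : ℕ) → Maybe (Fin k) → List (Fin k)
candidates k nothing  = allFin k
candidates k (just l) = filter (l <?_) (allFin k) ++ filter (_≤? l) (allFin k)

firstAvailable : (G : Graph) (k : ℕ) → List (Fin (nE G) × Fin k) → Fin (nE G) → List (Fin k) → Maybe (Fin k)
firstAvailable G k assigned e [] = nothing
firstAvailable G k assigned e (c ∷ cs) =
  if availableB G k assigned e c then just c else firstAvailable G k assigned e cs

-- state: last used colour, list of (edge, colour) assignments made so far
NFState : Graph → ℕ → Set
NFState G k = Maybe (Fin k) × List (Fin (nE G) × Fin k)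

nfStep : (G : Graph) (k : ℕ) → NFState G k → Fin (nE G) → NFState G k
nfStep G k (last , assigned) e with firstAvailable G k assigned e (candidates k last)
... | just c  = (just c , (e , c) ∷ assigned)
... | nothing = (last , assigned)

nfRun : (G : Graph) (k : ℕ) → NFState G k → List (Fin (nE G)) → NFState G k
nfRun G k s []       = s
nfRun G k s (e ∷ es) = nfRun G k (nfStep G k s e) es

lookupColour : ∀ {m k} → List (Fin m × Fin k) → Fin m → Maybe (Fin k)
lookupColour [] e = nothing
lookupColour ((f , c) ∷ ps) e = if eqB e f then just c else lookupColour ps e

-- Colour given by Next-Fit to each edge (nothing = rejected / not coloured)
nextFit : (G : Graph) (k : ℕ) → List (Fin (nE G)) → Fin (nE G) → Maybe (Fin k)
nextFit G k order = lookupColour (proj₂ (nfRun G k (nothing , []) order))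

-- Give copy i of edge e the colour c(e) + i (mod k).  This colouring of the k copies is proper,
-- and the k copies of each edge of G receive all k colours.  Present the edges of the copies
-- edge of G by edge of G, each group in increasing order of its colours: the colours then run
-- 1, 2, …, k, 1, 2, …, k, …, so every colour is the first one Next-Fit tries, and it is free
-- because the colouring is proper.  Hence Next-Fit reproduces this colouring, which on copy i
-- is c followed by the rotation by i.
module Submission where

open import Defs
open import Data.Nat as ℕ using (ℕ; zero; suc; _+_; _∸_; _%_; _*_; _≤_)
open import Data.Nat.Properties using (+-assoc; +-comm; *-comm; m∸n+n≡m; m+[n∸m]≡n; <⇒≤; ≤-reflexive; <⇒≱; ≤⇒≯; suc-injective)
open import Data.Nat.DivMod using (_mod_; %-distribˡ-+; m%n%n≡m%n; [m+n]%n≡m%n; m<n⇒m%n≡m)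
open import Data.Fin as Fin using (Fin; zero; suc; toℕ; fromℕ; inject₁; combine; remQuot; _≟_; _<?_; _≤?_)
open import Data.Fin.Properties using (toℕ-fromℕ<; toℕ-injective; toℕ<n; toℕ-inject₁; ≤fromℕ; remQuot-combine; combine-remQuot; combine-injectiveˡ; combine-injectiveʳ)
open import Data.Fin.Permutation using (Permutation′; permutation; _⟨$⟩ʳ_)
open import Data.List using (List; []; _∷_; _++_; _ʳ++_; filter; allFin; tabulate; map; concatMap; length)
open import Data.List.Properties using (map-tabulate; tabulate-cong; filter-accept; filter-reject; filter-none; map-concatMap; concatMap-cong; length-++; length-tabulate)
import Data.List.Relation.Unary.All as All
open import Data.List.Relation.Unary.All.Properties using (tabulate⁺)
open import Data.List.Relation.Unary.Any using (here; there)
open import Data.List.Relation.Unary.Any.Properties using (reverse⁺)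
open import Data.List.Membership.Propositional using (_∈_)
open import Data.List.Membership.Propositional.Properties using (∈-tabulate⁺; ∈-map⁺; ∈-allFin; ∈-concat⁺′; ∈-++⁺ˡ; ∈-++⁺ʳ; ∈-++⁻; ∈-∃++)
open import Data.List.Relation.Binary.Subset.Propositional using (_⊆_)
open import Data.List.Relation.Unary.Unique.Propositional using (Unique)
open import Data.List.Relation.Unary.AllPairs using (_∷_)
open import Data.List.Relation.Unary.Unique.Propositional.Properties using (allFin⁺)
open import Data.List.Relation.Binary.Permutation.Propositional using (_↭_; ↭-refl; ↭-trans; ↭-prep)
open import Data.List.Relation.Binary.Permutation.Propositional.Properties using (shift; ↭-length)
open import Data.Bool using (true; false; T; _∨_)
open import Data.Maybe using (Maybe; just; nothing)
open import Data.Product using (Σ; ∃; _×_; _,_; proj₁; proj₂; <_,_>)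
open import Data.Sum using (_⊎_; inj₁; inj₂)
open import Data.Empty using (⊥-elim)
open import Function using (id; _∘_; const)
open import Relation.Nullary using (Dec; ¬_; yes; no; does)
open import Relation.Binary.PropositionalEquality

private
  variable
    A : Set
    n : ℕ

module _ {n : ℕ} where

  rotate : ℕ → Fin (suc n) → Fin (suc n)
  rotate a i = (toℕ i + a) mod suc n

  toℕ-rotate : ∀ a (i : Fin (suc n)) → toℕ (rotate a i) ≡ (toℕ i + a) % suc n
  toℕ-rotate a i = toℕ-fromℕ< _

  rotate-rotate : ∀ a b (i : Fin (suc n)) → a + b ≡ suc n → rotate b (rotate a i) ≡ i
  rotate-rotate a b i a+b≡d = toℕ-injective (begin
    toℕ (rotate b (rotate a i))   ≡⟨ toℕ-rotate b (rotate a i) ⟩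
    (toℕ (rotate a i) + b) % d    ≡⟨ cong (λ r → (r + b) % d) (toℕ-rotate a i) ⟩
    ((m + a) % d + b) % d         ≡⟨ %-distribˡ-+ ((m + a) % d) b d ⟩
    ((m + a) % d % d + b % d) % d ≡⟨ cong (λ r → (r + b % d) % d) (m%n%n≡m%n (m + a) d) ⟩
    ((m + a) % d + b % d) % d     ≡⟨ %-distribˡ-+ (m + a) b d ⟨
    (m + a + b) % d               ≡⟨ cong (_% d) (trans (+-assoc m a b) (cong (m +_) a+b≡d)) ⟩
    (m + d) % d                   ≡⟨ [m+n]%n≡m%n m d ⟩
    m % d                         ≡⟨ m<n⇒m%n≡m (toℕ<n i) ⟩
    m                             ∎)
    where open ≡-Reasoning; d = suc n; m = toℕ i

  infixl 6 _⊕_ _⊖_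

  _⊕_ : Fin (suc n) → Fin (suc n) → Fin (suc n)
  i ⊕ j = rotate (toℕ j) i

  _⊖_ : Fin (suc n) → Fin (suc n) → Fin (suc n)
  i ⊖ j = rotate (suc n ∸ toℕ j) i

  ⊕-comm : ∀ i j → i ⊕ j ≡ j ⊕ i
  ⊕-comm i j = cong (_mod suc n) (+-comm (toℕ i) (toℕ j))

  ⊕-⊖-cancel : ∀ i j → i ⊕ j ⊖ j ≡ i
  ⊕-⊖-cancel i j = rotate-rotate _ _ i (m+[n∸m]≡n (<⇒≤ (toℕ<n j)))

  ⊖-⊕-cancel : ∀ i j → i ⊖ j ⊕ j ≡ i
  ⊖-⊕-cancel i j = rotate-rotate _ _ i (m∸n+n≡m (<⇒≤ (toℕ<n j)))

  ⊕-cancelʳ : ∀ {a b} i → a ⊕ i ≡ b ⊕ i → a ≡ b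
  ⊕-cancelʳ {a} {b} i eq = begin
    a         ≡⟨ ⊕-⊖-cancel a i ⟨
    a ⊕ i ⊖ i ≡⟨ cong (_⊖ i) eq ⟩
    b ⊕ i ⊖ i ≡⟨ ⊕-⊖-cancel b i ⟩
    b         ∎
    where open ≡-Reasoning

  rotation : Fin (suc n) → Permutation′ (suc n)
  rotation i = permutation (_⊕ i) (_⊖ i) (λ a → ⊖-⊕-cancel a i) (λ a → ⊕-⊖-cancel a i)

StartsWith : List A → A → Set
StartsWith xs x = ∃ λ rest → xs ≡ x ∷ rest

module _ {P : A → Set} (P? : ∀ x → Dec (P x)) where

  filter-tabulate-first : ∀ {m} (f : Fin m → A) i → (∀ j → j Fin.< i → ¬ P (f j)) → P (f i) →
                          StartsWith (filter P? (tabulate f)) (f i)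
  filter-tabulate-first f zero    earlier now = _ , filter-accept P? now
  filter-tabulate-first f (suc i) earlier now
    with rest , eq ← filter-tabulate-first (f ∘ suc) i (λ j j<i → earlier (suc j) (ℕ.s<s j<i)) now
    = rest , trans (filter-reject P? (earlier zero ℕ.z<s)) eq

∈-remove : ∀ {y z : A} as {bs} → y ≢ z → z ∈ as ++ y ∷ bs → z ∈ as ++ bs
∈-remove as y≢z z∈ with ∈-++⁻ as z∈
... | inj₁ z∈as         = ∈-++⁺ˡ z∈as
... | inj₂ (here z≡y)   = ⊥-elim (y≢z (sym z≡y))
... | inj₂ (there z∈bs) = ∈-++⁺ʳ as z∈bs

unique∧⊆∧length⇒↭ : ∀ {xs ys : List A} → Unique ys → ys ⊆ xs → length xs ≡ length ys → xs ↭ ys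
unique∧⊆∧length⇒↭ {xs = []} {[]} _ _ _ = ↭-refl
unique∧⊆∧length⇒↭ {ys = y ∷ ys} (y∉ys ∷ unique) ys⊆xs len
  with as , bs , refl ← ∈-∃++ (ys⊆xs (here refl)) =
  ↭-trans (shift y as bs)
          (↭-prep y (unique∧⊆∧length⇒↭ unique
                       (λ z∈ys → ∈-remove as (All.lookup y∉ys z∈ys) (ys⊆xs (there z∈ys)))
                       (suc-injective (trans (sym (↭-length (shift y as bs))) len))))

length-concatMap-const : ∀ {B : Set} (f : A → List B) {m} → (∀ x → length (f x) ≡ m) →
                         ∀ xs → length (concatMap f xs) ≡ length xs * m
length-concatMap-const f len []       = refl
length-concatMap-const f len (x ∷ xs) =
  trans (length-++ (f x)) (cong₂ _+_ (len x) (length-concatMap-const f len xs))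

FirstChoice : ∀ k → Maybe (Fin k) → Fin k → Set
FirstChoice k last c = StartsWith (candidates k last) c

firstChoice-start : FirstChoice (suc n) nothing zero
firstChoice-start = _ , refl

firstChoice-next : ∀ {k} (l c : Fin k) → toℕ c ≡ suc (toℕ l) → FirstChoice k (just l) c
firstChoice-next {k} l c c≡1+l =
  let rest , eq = filter-tabulate-first (l <?_) id c below-c (≤-reflexive (sym c≡1+l))
  in  rest ++ filter (_≤? l) (allFin k) , cong (_++ filter (_≤? l) (allFin k)) eq
  where
  below-c : ∀ j → j Fin.< c → ¬ l Fin.< j
  below-c j j<c l<j = <⇒≱ l<j (ℕ.s≤s⁻¹ (subst (suc (toℕ j) ≤_) c≡1+l j<c))

firstChoice-wrap : FirstChoice (suc n) (just (fromℕ n)) zero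
firstChoice-wrap {n} = _ , trans
  (cong (_++ filter (_≤? fromℕ n) (allFin (suc n)))
        (filter-none (fromℕ n <?_) (tabulate⁺ (λ i → ≤⇒≯ (≤fromℕ i)))))
  (filter-accept (_≤? fromℕ n) {xs = tabulate suc} (≤fromℕ zero))

data FirstChoices {k} : Maybe (Fin k) → List (Fin k) → Maybe (Fin k) → Set where
  []  : ∀ {last} → FirstChoices last [] last
  _∷_ : ∀ {last c cs last′} →
        FirstChoice k last c → FirstChoices (just c) cs last′ → FirstChoices last (c ∷ cs) last′

firstChoices-++ : ∀ {k} {l m r : Maybe (Fin k)} {xs ys} →
                  FirstChoices l xs m → FirstChoices m ys r → FirstChoices l (xs ++ ys) r
firstChoices-++ []         q = q
firstChoices-++ (c ∷ p) q = c ∷ firstChoices-++ p q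

tabulate-firstChoices : ∀ {k m last} (f : Fin (suc m) → Fin k) → FirstChoice k last (f zero) →
                        (∀ i → toℕ (f (suc i)) ≡ suc (toℕ (f (inject₁ i)))) →
                        FirstChoices last (tabulate f) (just (f (fromℕ m)))
tabulate-firstChoices {m = zero}  f first step = first ∷ []
tabulate-firstChoices {m = suc m} f first step =
  first ∷ tabulate-firstChoices (f ∘ suc) (firstChoice-next (f zero) (f (suc zero)) (step zero)) (step ∘ suc)

allFin-firstChoices : ∀ {last} → FirstChoice (suc n) last zero →
                      FirstChoices last (allFin (suc n)) (just (fromℕ n))
allFin-firstChoices first = tabulate-firstChoices id first (λ i → cong suc (sym (toℕ-inject₁ i)))

concatMap-allFin-firstChoices : ∀ (xs : List A) {last} → FirstChoice (suc n) last zero →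
                                ∃ λ last′ → FirstChoices last (concatMap (const (allFin (suc n))) xs) last′
concatMap-allFin-firstChoices []       first = _ , []
concatMap-allFin-firstChoices (x ∷ xs) first
  with last′ , rest ← concatMap-allFin-firstChoices xs firstChoice-wrap
  = last′ , firstChoices-++ (allFin-firstChoices first) rest

-- Next-Fit follows a proper colouring presented in its order of preference

shared-endpoint : ∀ {a₁ a₂ b₁ b₂ : Fin n} →
                  T (does (a₁ ≟ b₁) ∨ does (a₁ ≟ b₂) ∨ does (a₂ ≟ b₁) ∨ does (a₂ ≟ b₂)) →
                  ∃ λ v → (v ≡ a₁ ⊎ v ≡ a₂) × (v ≡ b₁ ⊎ v ≡ b₂)
shared-endpoint {a₁ = a₁} {a₂} {b₁} {b₂} t with a₁ ≟ b₁ | a₁ ≟ b₂ | a₂ ≟ b₁ | a₂ ≟ b₂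
... | yes p | _     | _     | _     = a₁ , inj₁ refl , inj₁ p
... | no _  | yes p | _     | _     = a₁ , inj₁ refl , inj₂ p
... | no _  | no _  | yes p | _     = a₂ , inj₂ refl , inj₁ p
... | no _  | no _  | no _  | yes p = a₂ , inj₂ refl , inj₂ p

adjB-sound : ∀ G e f → T (adjB G e f) → Adjacent G e f
adjB-sound G e f t with e ≟ f
... | no e≢f = e≢f , shared-endpoint t

module _ {k} (G : Graph) {κ : Fin (nE G) → Fin k} (proper : IsProperEdgeColoring G k κ) where

  available : ∀ x ys → availableB G k (map < id , κ > ys) x (κ x) ≡ true
  available x []       = refl
  available x (y ∷ ys) with adjB G x y in adj | κ x ≟ κ y
  ... | false | _      = available x ys
  ... | true  | no _   = available x ys
  ... | true  | yes eq = ⊥-elim (proper x y (adjB-sound G x y (subst T (sym adj) _)) eq)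

  nfStep-firstChoice : ∀ {last as x c} → FirstChoice k last c → availableB G k as x c ≡ true →
                       nfStep G k (last , as) x ≡ (just c , (x , c) ∷ as)
  nfStep-firstChoice (rest , eq) free rewrite eq | free = refl

  nfRun-follows : ∀ {last last′} xs ys → FirstChoices last (map κ xs) last′ →
                  nfRun G k (last , map < id , κ > ys) xs ≡ (last′ , map < id , κ > (xs ʳ++ ys))
  nfRun-follows []       ys []              = refl
  nfRun-follows (x ∷ xs) ys (first ∷ rest) =
    trans (cong (λ s → nfRun G k s xs) (nfStep-firstChoice first (available x ys)))
          (nfRun-follows xs (x ∷ ys) rest)

lookupColour-graph : ∀ {m k} (κ : Fin m → Fin k) {x} xs → x ∈ xs → lookupColour (map < id , κ > xs) x ≡ just (κ x)
lookupColour-graph κ {x} (y ∷ ys) x∈ with x ≟ y | x∈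
... | yes refl | _           = refl
... | no x≢y   | here x≡y    = ⊥-elim (x≢y x≡y)
... | no _     | there x∈ys  = lookupColour-graph κ ys x∈ys

nextFit-follows : ∀ {k} G {κ : Fin (nE G) → Fin k} → IsProperEdgeColoring G k κ →
                  ∀ {last′} order → FirstChoices nothing (map κ order) last′ →
                  ∀ {x} → x ∈ order → nextFit G k order x ≡ just (κ x)
nextFit-follows G {κ} proper order choices x∈order
  rewrite nfRun-follows G proper order [] choices = lookupColour-graph κ (order ʳ++ []) (reverse⁺ x∈order)

module _ (k : ℕ) (G : Graph) where

  copyIndex : Fin (k * nE G) → Fin k
  copyIndex x = proj₁ (remQuot {k} (nE G) x)

  baseEdge : Fin (k * nE G) → Fin (nE G)
  baseEdge x = proj₂ (remQuot {k} (nE G) x)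

  incident-copies : ∀ {v x} → Incident (copies k G) v x →
                    ∃ λ u → Incident G u (baseEdge x) × v ≡ combine (copyIndex x) u
  incident-copies (inj₁ refl) = _ , inj₁ refl , refl
  incident-copies (inj₂ refl) = _ , inj₂ refl , refl

  copy-injective : ∀ {x y} → copyIndex x ≡ copyIndex y → baseEdge x ≡ baseEdge y → x ≡ y
  copy-injective {x} {y} i≡j e≡f = begin
    x                                   ≡⟨ combine-remQuot {k} (nE G) x ⟨
    combine (copyIndex x) (baseEdge x)  ≡⟨ cong₂ combine i≡j e≡f ⟩
    combine (copyIndex y) (baseEdge y)  ≡⟨ combine-remQuot {k} (nE G) y ⟩
    y                                   ∎
    where open ≡-Reasoning

  adjacent-copies : ∀ {x y} → Adjacent (copies k G) x y →
                    copyIndex x ≡ copyIndex y × Adjacent G (baseEdge x) (baseEdge y)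
  adjacent-copies {x} {y} (x≢y , v , vx , vy) =
    let u  , ux , v≡xu  = incident-copies vx
        u′ , uy , v≡yu′ = incident-copies vy
        xu≡yu′ = trans (sym v≡xu) v≡yu′
        same-copy = combine-injectiveˡ (copyIndex x) u (copyIndex y) u′ xu≡yu′
        u≡u′      = combine-injectiveʳ (copyIndex x) u (copyIndex y) u′ xu≡yu′
    in  same-copy
      , (λ e≡f → x≢y (copy-injective same-copy e≡f))
      , u , ux , subst (λ w → Incident G w (baseEdge y)) (sym u≡u′) uy

module CyclicCopies {n} (G : Graph) (c : Fin (nE G) → Fin (suc n))
                    (proper : IsProperEdgeColoring G (suc n) c) where

  private
    k = suc n
    N = nE G

  colouring : Fin (k * N) → Fin k
  colouring x = c (baseEdge k G x) ⊕ copyIndex k G x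

  colouring-combine : ∀ i e → colouring (combine i e) ≡ c e ⊕ i
  colouring-combine i e = cong (λ (j , f) → c f ⊕ j) (remQuot-combine {k} i e)

  colouring-proper : IsProperEdgeColoring (copies k G) k colouring
  colouring-proper x y adj same =
    let i≡j , adjG = adjacent-copies k G adj
    in  proper _ _ adjG (⊕-cancelʳ (copyIndex k G x) (trans same (cong (c (baseEdge k G y) ⊕_) (sym i≡j))))

  copyWithColour : Fin N → Fin k → Fin (k * N)
  copyWithColour e p = combine (p ⊖ c e) e

  colouring-copyWithColour : ∀ e p → colouring (copyWithColour e p) ≡ p
  colouring-copyWithColour e p = begin
    colouring (combine (p ⊖ c e) e) ≡⟨ colouring-combine (p ⊖ c e) e ⟩
    c e ⊕ (p ⊖ c e)                 ≡⟨ ⊕-comm (c e) (p ⊖ c e) ⟩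
    p ⊖ c e ⊕ c e                   ≡⟨ ⊖-⊕-cancel p (c e) ⟩
    p                               ∎
    where open ≡-Reasoning

  block : Fin N → List (Fin (k * N))
  block e = tabulate (copyWithColour e)

  order : List (Fin (k * N))
  order = concatMap block (allFin N)

  map-colouring-order : map colouring order ≡ concatMap (const (allFin k)) (allFin N)
  map-colouring-order = trans (map-concatMap colouring block (allFin N)) (concatMap-cong colours-of-block (allFin N))
    where
    colours-of-block : ∀ e → map colouring (block e) ≡ allFin k
    colours-of-block e = trans (map-tabulate (copyWithColour e) colouring) (tabulate-cong (colouring-copyWithColour e))

  order-firstChoices : ∃ λ last → FirstChoices nothing (map colouring order) last
  order-firstChoices rewrite map-colouring-order = concatMap-allFin-firstChoices (allFin N) firstChoice-start

  ∈-order : ∀ x → x ∈ order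
  ∈-order x = ∈-concat⁺′ (subst (_∈ block e) copy≡x (∈-tabulate⁺ {f = copyWithColour e} (i ⊕ c e)))
                         (∈-map⁺ block (∈-allFin e))
    where
    i = copyIndex k G x
    e = baseEdge k G x
    copy≡x : copyWithColour e (i ⊕ c e) ≡ x
    copy≡x = trans (cong (λ j → combine j e) (⊕-⊖-cancel i (c e))) (combine-remQuot {k} N x)

  order-↭ : order ↭ allFin (k * N)
  order-↭ = unique∧⊆∧length⇒↭ (allFin⁺ (k * N)) (λ {x} _ → ∈-order x) (begin
    length order                   ≡⟨ length-concatMap-const block (λ e → length-tabulate (copyWithColour e)) (allFin N) ⟩
    length (allFin N) * k          ≡⟨ cong (_* k) (length-tabulate {n = N} id) ⟩
    N * k                          ≡⟨ *-comm N k ⟩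
    k * N                          ≡⟨ length-tabulate id ⟨
    length (allFin (k * N))        ∎)
    where open ≡-Reasoning

corollary2 : (k : ℕ) → 1 ≤ k → (G : Graph) → IsSimple G →
    (c : Fin (nE G) → Fin k) → IsProperEdgeColoring G k c →
    Σ (List (Fin (nE (copies k G)))) (λ order →
      (order ↭ allFin (nE (copies k G))) ×
      ((i : Fin k) → Σ (Permutation′ k) (λ π →
        (e : Fin (nE G)) → nextFit (copies k G) k order (combine {k} i e) ≡ just (π ⟨$⟩ʳ c e))))
corollary2 (suc n) _ G _ c proper =
  order , order-↭ , λ i → rotation i , λ e → begin
    nextFit (copies k G) k order (combine i e)
      ≡⟨ nextFit-follows (copies k G) colouring-proper order (proj₂ order-firstChoices) (∈-order (combine i e)) ⟩
    just (colouring (combine i e))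
      ≡⟨ cong just (colouring-combine i e) ⟩
    just (c e ⊕ i)
      ∎
  where
  open CyclicCopies G c proper
  open ≡-Reasoning
  k = suc n
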